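{- Let $\vdash_1$ denote derivability in System 1 and $\vdash_2$ derivability in System 2 (defined in the context). Then for every $\varphi\in\Phi$, $\vdash_1\varphi$ if and only if $\vdash_2\varphi$.
   Context: Fix a nonempty finite set $AG$ of agents and a countable set $AP$ of atomic propositions; a coalition is any $A\subseteq AG$. The language $\Phi$: $\varphi ::= \top \mid p \mid \neg\varphi \mid (\varphi\wedge\varphi) \mid \langle A\rangle\varphi$ ($p\in AP$, $A\subseteq AG$), with $\bot,\vee,\to,\leftrightarrow$ defined as usual. System 1 has axioms (for all $\varphi,\psi$ and coalitions): all propositional tautologies; $\langle A\rangle(\varphi\wedge\psi)\to\langle A\rangle\varphi$; $\neg\langle A\rangle\bot$; $\langle A\rangle\top$; $(\langle A\rangle\varphi\wedge\langle B\rangle\psi)\to\langle A\cup B\rangle(\varphi\wedge\psi)$ whenever $A\cap B=\emptyset$; $\neg\langle\emptyset\rangle\neg\varphi\to\langle AG\rangle\varphi$; and rules: modus ponens, and from $\varphi\leftrightarrow\psi$ infer $\langle A\rangle\varphi\leftrightarrow\langle A\rangle\psi$. System 2 has axioms: all propositional tautologies; $\langle\emptyset\rangle(\varphi\to\psi)\to(\langle A\rangle\varphi\to\langle A\rangle\psi)$; $\langle A\rangle\varphi\to\langle B\rangle\varphi$ whenever $A\subseteq B$; $\neg\langle A\rangle\bot$; $\langle A\rangle\top$; $(\langle A\rangle\varphi\wedge\langle B\rangle\psi)\to\langle A\cup B\rangle(\varphi\wedge\psi)$ whenever $A\cap B=\emptyset$; $\langle A\rangle(\varphi\vee\psi)\to(\langle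 A\rangle\varphi\vee\langle AG\rangle\psi)$; and rules: modus ponens, and from $\varphi$ infer $\langle A\rangle\psi\to\langle\emptyset\rangle\varphi$. -}

module Defs where

open import Data.Nat using (ℕ)
open import Data.Bool using (Bool; true; false; not; _∧_)
open import Data.Fin.Subset using (Subset; _∩_; _∪_; _⊆_; ⊥; ⊤)
open import Relation.Binary.PropositionalEquality using (_≡_)

-- Agents: AG = Fin m with m = suc n (nonempty finite); atoms: AP = ℕ (countable).
-- Coalitions: subsets of AG.

data Form (m : ℕ) : Set where
  ⊤'   : Form m
  atom : ℕ → Form m
  ¬'_  : Form m → Form m
  _∧'_ : Form m → Form m → Form m
  ⟨_⟩_ : Subset m → Form m → Form m

infixr 6 _∧'_
infix 7 ¬'_
infix 8 ⟨_⟩_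

module _ {m : ℕ} where
  ⊥' : Form m
  ⊥' = ¬' ⊤'

  _∨'_ : Form m → Form m → Form m
  φ ∨' ψ = ¬' ((¬' φ) ∧' (¬' ψ))

  _⇒'_ : Form m → Form m → Form m
  φ ⇒' ψ = ¬' (φ ∧' (¬' ψ))

  _⇔'_ : Form m → Form m → Form m
  φ ⇔' ψ = (φ ⇒' ψ) ∧' (ψ ⇒' φ)

  infixr 5 _∨'_
  infixr 4 _⇒'_
  infix 3 _⇔'_

  -- Propositional evaluation: atoms and modal formulas ⟨A⟩φ are treated as
  -- propositional letters, interpreted by an arbitrary assignment.
  record Valuation : Set where
    field
      vAtom  : ℕ → Bool
      vModal : Subset m → Form m → Bool

  eval : Valuation → Form m → Bool
  eval v ⊤'        = true
  eval v (atom p)  = Valuation.vAtom v p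
  eval v (¬' φ)    = not (eval v φ)
  eval v (φ ∧' ψ)  = eval v φ ∧ eval v ψ
  eval v (⟨ A ⟩ φ) = Valuation.vModal v A φ

  Tautology : Form m → Set
  Tautology φ = (v : Valuation) → eval v φ ≡ true

  Disjoint : Subset m → Subset m → Set
  Disjoint A B = A ∩ B ≡ ⊥

  data ⊢₁_ : Form m → Set where
    taut    : ∀ {φ} → Tautology φ → ⊢₁ φ
    mono∧   : ∀ A φ ψ → ⊢₁ (⟨ A ⟩ (φ ∧' ψ) ⇒' ⟨ A ⟩ φ)
    noBot   : ∀ A → ⊢₁ (¬' (⟨ A ⟩ ⊥'))
    top     : ∀ A → ⊢₁ (⟨ A ⟩ ⊤')
    superadd : ∀ A B φ ψ → Disjoint A B →
               ⊢₁ ((⟨ A ⟩ φ ∧' ⟨ B ⟩ ψ) ⇒' ⟨ A ∪ B ⟩ (φ ∧' ψ))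
    maximal : ∀ φ → ⊢₁ (¬' (⟨ ⊥ ⟩ (¬' φ)) ⇒' ⟨ ⊤ ⟩ φ)
    mp      : ∀ {φ ψ} → ⊢₁ (φ ⇒' ψ) → ⊢₁ φ → ⊢₁ ψ
    re      : ∀ {φ ψ} A → ⊢₁ (φ ⇔' ψ) → ⊢₁ (⟨ A ⟩ φ ⇔' ⟨ A ⟩ ψ)

  data ⊢₂_ : Form m → Set where
    taut     : ∀ {φ} → Tautology φ → ⊢₂ φ
    kEmpty   : ∀ A φ ψ → ⊢₂ (⟨ ⊥ ⟩ (φ ⇒' ψ) ⇒' (⟨ A ⟩ φ ⇒' ⟨ A ⟩ ψ))
    coalMono : ∀ A B φ → A ⊆ B → ⊢₂ (⟨ A ⟩ φ ⇒' ⟨ B ⟩ φ)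
    noBot    : ∀ A → ⊢₂ (¬' (⟨ A ⟩ ⊥'))
    top      : ∀ A → ⊢₂ (⟨ A ⟩ ⊤')
    superadd : ∀ A B φ ψ → Disjoint A B →
               ⊢₂ ((⟨ A ⟩ φ ∧' ⟨ B ⟩ ψ) ⇒' ⟨ A ∪ B ⟩ (φ ∧' ψ))
    crown    : ∀ A φ ψ → ⊢₂ (⟨ A ⟩ (φ ∨' ψ) ⇒' (⟨ A ⟩ φ ∨' ⟨ ⊤ ⟩ ψ))
    mp       : ∀ {φ ψ} → ⊢₂ (φ ⇒' ψ) → ⊢₂ φ → ⊢₂ ψ
    nec      : ∀ {φ} A ψ → ⊢₂ φ → ⊢₂ (⟨ A ⟩ ψ ⇒' ⟨ ⊥ ⟩ φ)

{-# OPTIONS --safe #-}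
-- Both systems are closed under the monotonicity rule "from φ → ψ infer ⟨A⟩φ → ⟨A⟩ψ": System 1
-- gets it from RE and ⟨A⟩(ψ ∧ φ) → ⟨A⟩ψ, System 2 from the K-axiom and necessitation for ⟨∅⟩.
-- With it each system derives the other's axioms. Maximality is the crown axiom instantiated at
-- ⟨∅⟩(¬φ ∨ φ). Conversely, K for ⟨∅⟩ and crown come from superadditivity with the empty coalition
-- (crown also using maximality), and coalition monotonicity A ⊆ B from superadditivity of A with
-- B ∖ A, which can always force ⊤.
module Submission where

open import Defs
open import Data.Nat using (ℕ; zero; suc)
open import Data.Bool using (Bool; true; false; not; _∧_)
open import Data.Bool.Properties using (∧-conicalˡ; ∧-conicalʳ)
open import Data.Vec using ([]; _∷_; here)
open import Data.Fin.Subset using (Subset; inside; outside; ⊥; _∩_; _∪_; _─_; _⊆_)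
open import Data.Fin.Subset.Properties using (drop-∷-⊆; ∩-zeroˡ; ∪-identityˡ)
open import Function.Bundles using (_⇔_; mk⇔)
open import Relation.Binary.PropositionalEquality using (_≡_; refl; cong; subst)
open import Relation.Nullary using (contradiction)

BoolFunction : ℕ → Set
BoolFunction zero    = Bool
BoolFunction (suc k) = Bool → BoolFunction k

AlwaysTrue : ∀ k → BoolFunction k → Set
AlwaysTrue zero    b = b ≡ true
AlwaysTrue (suc k) f = ∀ b → AlwaysTrue k (f b)

truthTable : ∀ k → BoolFunction k → Bool
truthTable zero    b = b
truthTable (suc k) f = truthTable k (f true) ∧ truthTable k (f false)

truthTable-sound : ∀ k (f : BoolFunction k) → truthTable k f ≡ true → AlwaysTrue k f
truthTable-sound zero    b t       = t
truthTable-sound (suc k) f t true  = truthTable-sound k (f true) (∧-conicalˡ _ _ t)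
truthTable-sound (suc k) f t false = truthTable-sound k (f false) (∧-conicalʳ _ _ t)

-- These agree definitionally with `eval` on _⇒'_ and _∨'_, so a truth table proves `Tautology` directly.
_⇒ᵇ_ _∨ᵇ_ : Bool → Bool → Bool
a ⇒ᵇ b = not (a ∧ not b)
a ∨ᵇ b = not (not a ∧ not b)

infixr 5 _∨ᵇ_
infixr 4 _⇒ᵇ_

p∩[q─p]≡⊥ : ∀ {n} (p q : Subset n) → p ∩ (q ─ p) ≡ ⊥
p∩[q─p]≡⊥ []            []      = refl
p∩[q─p]≡⊥ (inside  ∷ p) (_ ∷ q) = cong (outside ∷_) (p∩[q─p]≡⊥ p q)
p∩[q─p]≡⊥ (outside ∷ p) (_ ∷ q) = cong (outside ∷_) (p∩[q─p]≡⊥ p q)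

p⊆q⇒p∪[q─p]≡q : ∀ {n} {p q : Subset n} → p ⊆ q → p ∪ (q ─ p) ≡ q
p⊆q⇒p∪[q─p]≡q {p = []}          {[]}          _   = refl
p⊆q⇒p∪[q─p]≡q {p = outside ∷ p} {y ∷ q}       p⊆q = cong (y ∷_) (p⊆q⇒p∪[q─p]≡q (drop-∷-⊆ p⊆q))
p⊆q⇒p∪[q─p]≡q {p = inside  ∷ p} {inside ∷ q}  p⊆q = cong (inside ∷_) (p⊆q⇒p∪[q─p]≡q (drop-∷-⊆ p⊆q))
p⊆q⇒p∪[q─p]≡q {p = inside  ∷ p} {outside ∷ q} p⊆q = contradiction (p⊆q here) λ ()

module PropositionalReasoning {m : ℕ} (⊢_ : Form m → Set)
  (taut : ∀ {φ} → Tautology φ → ⊢ φ)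
  (mp   : ∀ {φ ψ} → ⊢ (φ ⇒' ψ) → ⊢ φ → ⊢ ψ) where

  private variable φ ψ χ θ : Form m

  tautological-rule₁ : Tautology (φ ⇒' ψ) → ⊢ φ → ⊢ ψ
  tautological-rule₁ t = mp (taut t)

  tautological-rule₂ : Tautology (φ ⇒' ψ ⇒' χ) → ⊢ φ → ⊢ ψ → ⊢ χ
  tautological-rule₂ t p = mp (mp (taut t) p)

  excluded-middle : ⊢ (¬' φ ∨' φ)
  excluded-middle {φ} = taut λ v →
    truthTable-sound 1 (λ a → not a ∨ᵇ a) refl (eval v φ)

  ∧-projˡ : ⊢ (φ ∧' ψ ⇒' φ)
  ∧-projˡ {φ} {ψ} = taut λ v →
    truthTable-sound 2 (λ a b → a ∧ b ⇒ᵇ a) refl (eval v φ) (eval v ψ)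

  modus-ponens : ⊢ ((φ ⇒' ψ) ∧' φ ⇒' ψ)
  modus-ponens {φ} {ψ} = taut λ v →
    truthTable-sound 2 (λ a b → (a ⇒ᵇ b) ∧ a ⇒ᵇ b) refl (eval v φ) (eval v ψ)

  disjunctive-syllogism : ⊢ (¬' ψ ∧' (φ ∨' ψ) ⇒' φ)
  disjunctive-syllogism {ψ} {φ} = taut λ v →
    truthTable-sound 2 (λ a b → not b ∧ (a ∨ᵇ b) ⇒ᵇ a) refl (eval v φ) (eval v ψ)

  ∧-intro : ⊢ φ → ⊢ ψ → ⊢ (φ ∧' ψ)
  ∧-intro {φ} {ψ} = tautological-rule₂ λ v →
    truthTable-sound 2 (λ a b → a ⇒ᵇ b ⇒ᵇ a ∧ b) refl (eval v φ) (eval v ψ)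

  ∧-elimˡ : ⊢ (φ ∧' ψ) → ⊢ φ
  ∧-elimˡ = mp ∧-projˡ

  ∧-elimʳ : ⊢ (φ ∧' ψ) → ⊢ ψ
  ∧-elimʳ {φ} {ψ} = tautological-rule₁ λ v →
    truthTable-sound 2 (λ a b → a ∧ b ⇒ᵇ b) refl (eval v φ) (eval v ψ)

  ⇒-const : ⊢ φ → ⊢ (ψ ⇒' φ)
  ⇒-const {φ} {ψ} = tautological-rule₁ λ v →
    truthTable-sound 2 (λ a b → a ⇒ᵇ b ⇒ᵇ a) refl (eval v φ) (eval v ψ)

  ⇒-trans : ⊢ (φ ⇒' ψ) → ⊢ (ψ ⇒' χ) → ⊢ (φ ⇒' χ)
  ⇒-trans {φ} {ψ} {χ} = tautological-rule₂ λ v →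
    truthTable-sound 3 (λ a b c → (a ⇒ᵇ b) ⇒ᵇ (b ⇒ᵇ c) ⇒ᵇ a ⇒ᵇ c) refl
      (eval v φ) (eval v ψ) (eval v χ)

  ∧⇒-curry : ⊢ (φ ∧' ψ ⇒' χ) → ⊢ (φ ⇒' ψ ⇒' χ)
  ∧⇒-curry {φ} {ψ} {χ} = tautological-rule₁ λ v →
    truthTable-sound 3 (λ a b c → (a ∧ b ⇒ᵇ c) ⇒ᵇ a ⇒ᵇ b ⇒ᵇ c) refl
      (eval v φ) (eval v ψ) (eval v χ)

  ∧⇒-discharge : ⊢ (φ ∧' ψ ⇒' χ) → ⊢ ψ → ⊢ (φ ⇒' χ)
  ∧⇒-discharge {φ} {ψ} {χ} = tautological-rule₂ λ v →
    truthTable-sound 3 (λ a b c → (a ∧ b ⇒ᵇ c) ⇒ᵇ b ⇒ᵇ a ⇒ᵇ c) refl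
      (eval v φ) (eval v ψ) (eval v χ)

  ⇒-by-cases : ⊢ (χ ∧' φ ⇒' ψ) → ⊢ (¬' χ ⇒' θ) → ⊢ (φ ⇒' ψ ∨' θ)
  ⇒-by-cases {χ} {φ} {ψ} {θ} = tautological-rule₂ λ v →
    truthTable-sound 4 (λ x a b c → (x ∧ a ⇒ᵇ b) ⇒ᵇ (not x ⇒ᵇ c) ⇒ᵇ a ⇒ᵇ b ∨ᵇ c) refl
      (eval v χ) (eval v φ) (eval v ψ) (eval v θ)

  ⇒-to-⇔-∧ : ⊢ (φ ⇒' ψ) → ⊢ (φ ⇔' ψ ∧' φ)
  ⇒-to-⇔-∧ {φ} {ψ} = tautological-rule₁ λ v →
    truthTable-sound 2 (λ a b → (a ⇒ᵇ b) ⇒ᵇ (a ⇒ᵇ b ∧ a) ∧ (b ∧ a ⇒ᵇ a)) refl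
      (eval v φ) (eval v ψ)

module _ {m : ℕ} where
  open PropositionalReasoning (⊢₂_ {m}) taut mp

  private variable φ ψ : Form m

  necessitation-∅₂ : ⊢₂ φ → ⊢₂ (⟨ ⊥ ⟩ φ)
  necessitation-∅₂ ⊢φ = mp (nec ⊥ ⊤' ⊢φ) (top ⊥)

  monotonicity₂ : ∀ A → ⊢₂ (φ ⇒' ψ) → ⊢₂ (⟨ A ⟩ φ ⇒' ⟨ A ⟩ ψ)
  monotonicity₂ {φ} {ψ} A ⊢φ⇒ψ = mp (kEmpty A φ ψ) (necessitation-∅₂ ⊢φ⇒ψ)

  ⊢₁⇒⊢₂ : ⊢₁ φ → ⊢₂ φ
  ⊢₁⇒⊢₂ (taut t)               = taut t
  ⊢₁⇒⊢₂ (mono∧ A _ _)          = monotonicity₂ A ∧-projˡ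
  ⊢₁⇒⊢₂ (noBot A)              = noBot A
  ⊢₁⇒⊢₂ (top A)                = top A
  ⊢₁⇒⊢₂ (superadd A B φ ψ A∩B) = superadd A B φ ψ A∩B
  -- ¬ ⟨∅⟩ ¬ φ ⇒' ⟨AG⟩ φ  is literally the disjunction  ⟨∅⟩ ¬ φ ∨' ⟨AG⟩ φ.
  ⊢₁⇒⊢₂ (maximal φ)            = mp (crown ⊥ (¬' φ) φ) (necessitation-∅₂ excluded-middle)
  ⊢₁⇒⊢₂ (mp ⊢φ⇒ψ ⊢φ)           = mp (⊢₁⇒⊢₂ ⊢φ⇒ψ) (⊢₁⇒⊢₂ ⊢φ)
  ⊢₁⇒⊢₂ (re A ⊢φ⇔ψ)            =
    ∧-intro (monotonicity₂ A (∧-elimˡ ⊢₂φ⇔ψ)) (monotonicity₂ A (∧-elimʳ ⊢₂φ⇔ψ))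
    where ⊢₂φ⇔ψ = ⊢₁⇒⊢₂ ⊢φ⇔ψ

module _ {m : ℕ} where
  open PropositionalReasoning (⊢₁_ {m}) taut mp

  private variable φ ψ : Form m

  monotonicity₁ : ∀ A → ⊢₁ (φ ⇒' ψ) → ⊢₁ (⟨ A ⟩ φ ⇒' ⟨ A ⟩ ψ)
  monotonicity₁ {φ} {ψ} A ⊢φ⇒ψ = ⇒-trans (∧-elimˡ (re A (⇒-to-⇔-∧ ⊢φ⇒ψ))) (mono∧ A ψ φ)

  necessitation₁ : ∀ A → ⊢₁ φ → ⊢₁ (⟨ A ⟩ φ)
  necessitation₁ A ⊢φ = mp (monotonicity₁ A (⇒-const ⊢φ)) (top A)

  superadd-∅₁ : ∀ (A : Subset m) (φ ψ : Form m) → ⊢₁ (⟨ ⊥ ⟩ φ ∧' ⟨ A ⟩ ψ ⇒' ⟨ A ⟩ (φ ∧' ψ))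
  superadd-∅₁ A φ ψ =
    subst (λ B → ⊢₁ (⟨ ⊥ ⟩ φ ∧' ⟨ A ⟩ ψ ⇒' ⟨ B ⟩ (φ ∧' ψ))) (∪-identityˡ A)
      (superadd ⊥ A φ ψ (∩-zeroˡ A))

  coalition-monotonicity₁ : ∀ {A B} φ → A ⊆ B → ⊢₁ (⟨ A ⟩ φ ⇒' ⟨ B ⟩ φ)
  coalition-monotonicity₁ {A} {B} φ A⊆B =
    ∧⇒-discharge (⇒-trans superadd-A-[B─A] (mono∧ B φ ⊤')) (top (B ─ A))
    where
    superadd-A-[B─A] : ⊢₁ (⟨ A ⟩ φ ∧' ⟨ B ─ A ⟩ ⊤' ⇒' ⟨ B ⟩ (φ ∧' ⊤'))
    superadd-A-[B─A] =
      subst (λ C → ⊢₁ (⟨ A ⟩ φ ∧' ⟨ B ─ A ⟩ ⊤' ⇒' ⟨ C ⟩ (φ ∧' ⊤'))) (p⊆q⇒p∪[q─p]≡q A⊆B)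
        (superadd A (B ─ A) φ ⊤' (p∩[q─p]≡⊥ A B))

  ⊢₂⇒⊢₁ : ⊢₂ φ → ⊢₁ φ
  ⊢₂⇒⊢₁ (taut t)               = taut t
  ⊢₂⇒⊢₁ (kEmpty A φ ψ)         =
    ∧⇒-curry (⇒-trans (superadd-∅₁ A (φ ⇒' ψ) φ) (monotonicity₁ A modus-ponens))
  ⊢₂⇒⊢₁ (coalMono _ _ φ A⊆B)   = coalition-monotonicity₁ φ A⊆B
  ⊢₂⇒⊢₁ (noBot A)              = noBot A
  ⊢₂⇒⊢₁ (top A)                = top A
  ⊢₂⇒⊢₁ (superadd A B φ ψ A∩B) = superadd A B φ ψ A∩B
  ⊢₂⇒⊢₁ (crown A φ ψ)          =
    ⇒-by-cases
      (⇒-trans (superadd-∅₁ A (¬' ψ) (φ ∨' ψ)) (monotonicity₁ A disjunctive-syllogism))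
      (maximal ψ)
  ⊢₂⇒⊢₁ (mp ⊢φ⇒ψ ⊢φ)           = mp (⊢₂⇒⊢₁ ⊢φ⇒ψ) (⊢₂⇒⊢₁ ⊢φ)
  ⊢₂⇒⊢₁ (nec _ _ ⊢φ)           = ⇒-const (necessitation₁ ⊥ (⊢₂⇒⊢₁ ⊢φ))

mainTheorem8 : (n : ℕ) (φ : Form (suc n)) → (⊢₁ φ) ⇔ (⊢₂ φ)
mainTheorem8 n φ = mk⇔ ⊢₁⇒⊢₂ ⊢₂⇒⊢₁
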